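{- Let $a_1,\dots,a_k$ be positive integers with $\sum_{i=1}^k 1/a_i>1.546$. Then $(a_1,\dots,a_k)$ is good.
   Context: A tuple $(a_1,\dots,a_k)$ of positive integers is good if there are sets $S_1,\dots,S_k\subseteq\mathbb{R}$ such that any two distinct elements of $S_i$ differ by at least $a_i$ and every integer belongs to $S_1\cup\dots\cup S_k$; otherwise it is bad. -}

module Defs where

open import Data.Nat using (ℕ; zero; suc; _≤_)
open import Data.Fin using (Fin; zero; suc)
open import Data.Integer as ℤ using (ℤ; +_; ∣_∣; _-_)
open import Data.Rational as ℚ using (ℚ; 0ℚ; _/_)
open import Data.Product using (Σ; ∃; _×_)
open import Relation.Nullary using (¬_)
open import Relation.Binary.PropositionalEquality using (_≡_)

-- reciprocal 1/a of a natural number (value at 0 is irrelevant: a ≥ 1 is assumed)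
recip : ℕ → ℚ
recip zero    = 0ℚ
recip (suc n) = + 1 / suc n

sumFin : (k : ℕ) → (Fin k → ℚ) → ℚ
sumFin zero    f = 0ℚ
sumFin (suc k) f = f zero ℚ.+ sumFin k (λ i → f (suc i))

Separated : ℕ → (ℤ → Set) → Set
Separated a S = ∀ x y → S x → S y → ¬ (x ≡ y) → a ≤ ∣ x - y ∣

Good : (k : ℕ) → (Fin k → ℕ) → Set₁
Good k a = Σ (Fin k → ℤ → Set) λ S →
  (∀ i → Separated (a i) (S i)) × (∀ (n : ℤ) → ∃ λ i → S i n)

module Submission where

-- Fix seven divisibility chains 1 = m₀ ∣ m₁ ∣ ⋯ with weights w_c summing to 31, and round
-- each a up to a modulus d_c(a) ≥ a of chain c.  A finite computation for a ≤ 64,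
-- propagated to all a by halving (every chain eventually doubles), shows
-- ∑_c w_c / d_c(a) ≥ (31/1.546)/a.  Summing over the a_i, some chain c has
-- ∑_i 1/d_c(a_i) ≥ 1.  Moduli from one divisibility chain with ∑ 1/m ≥ 1 are realised by
-- residue classes covering ℤ: place the classes greedily by decreasing modulus, reading
-- integers through their reversed mixed-radix expansion.  Finally, a residue class
-- modulo d ≥ a is a-separated.

module Fractions where

  open import Algebra.Bundles using (Ring)
  open import Data.Fin using (Fin; zero; suc)
  open import Data.Fin.Properties using (any?)
  open import Data.Integer as ℤ using (+_)
  import Data.Integer.Properties as ℤₚ
  open import Data.List using ([]; _∷_)
  open import Data.Nat
  open import Data.Nat.Properties
  open import Data.Nat.Tactic.RingSolver using (solve)
  open import Data.Product using (∃; _,_)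
  import Data.Rational as ℚ
  import Data.Rational.Properties as ℚₚ
  open import Data.Rational.Unnormalised as ℚᵘ using (ℚᵘ; mkℚᵘ; _≃_; *≡*; *≤*; 0ℚᵘ; 1ℚᵘ)
  import Data.Rational.Unnormalised.Properties as ℚᵘₚ
  open import Defs using (recip; sumFin)
  open import Function using (_∘_)
  open import Relation.Binary.PropositionalEquality using (_≡_; refl; sym; trans; cong; cong₂; subst; subst₂)
  open import Relation.Nullary using (yes; no; contradiction)

  import Algebra.Properties.Semiring.Sum +-*-semiring as ℕΣ
  open import Algebra.Properties.Semiring.Sum (Ring.semiring ℚᵘₚ.+-*-ring)
    using (sum; sum-syntax; sum-cong-≋)

  -- frac n d is n/d; at d = 0 it is n/1, whence the positivity hypotheses.
  frac : ℕ → ℕ → ℚᵘ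
  frac n d = mkℚᵘ (+ n) (pred d)

  frac-≃ : ∀ n d n′ d′ → 0 < d → 0 < d′ → n * d′ ≡ n′ * d → frac n d ≃ frac n′ d′
  frac-≃ n (suc d) n′ (suc d′) _ _ eq =
    *≡* (trans (sym (ℤₚ.pos-* n (suc d′))) (trans (cong +_ eq) (ℤₚ.pos-* n′ (suc d))))

  frac-≤ : ∀ n d n′ d′ → 0 < d → 0 < d′ → n * d′ ≤ n′ * d → frac n d ℚᵘ.≤ frac n′ d′
  frac-≤ n (suc d) n′ (suc d′) _ _ le =
    *≤* (subst₂ ℤ._≤_ (ℤₚ.pos-* n (suc d′)) (ℤₚ.pos-* n′ (suc d)) (ℤ.+≤+ le))

  frac-≤⁻ : ∀ n d n′ d′ → 0 < d → 0 < d′ → frac n d ℚᵘ.≤ frac n′ d′ → n * d′ ≤ n′ * d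
  frac-≤⁻ n (suc d) n′ (suc d′) _ _ (*≤* le) =
    ℤₚ.drop‿+≤+ (subst₂ ℤ._≤_ (sym (ℤₚ.pos-* n (suc d′))) (sym (ℤₚ.pos-* n′ (suc d))) le)

  frac-* : ∀ n d n′ d′ → 0 < d → 0 < d′ → frac n d ℚᵘ.* frac n′ d′ ≃ frac (n * n′) (d * d′)
  frac-* n (suc d) n′ (suc d′) _ _ =
    ℚᵘₚ.≃-reflexive (cong (λ z → mkℚᵘ z (d′ + d * suc d′)) (sym (ℤₚ.pos-* n n′)))

  frac≃n*1/d : ∀ n d → 0 < d → frac n d ≃ frac n 1 ℚᵘ.* frac 1 d
  frac≃n*1/d n d d>0 = ℚᵘₚ.≃-sym (ℚᵘₚ.≃-trans (frac-* n 1 1 d (s≤s z≤n) d>0)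
    (frac-≃ (n * 1) (1 * d) n d (subst (0 <_) (sym (*-identityˡ d)) d>0) d>0 (*-assoc n 1 d)))

  frac-+ : ∀ n n′ d → 0 < d → frac n d ℚᵘ.+ frac n′ d ≃ frac (n + n′) d
  frac-+ n n′ d@(suc d-1) d>0 = ℚᵘₚ.≃-trans
    (ℚᵘₚ.≃-reflexive (cong (λ z → mkℚᵘ z (d-1 + d-1 * d))
      (trans (cong₂ ℤ._+_ (sym (ℤₚ.pos-* n d)) (sym (ℤₚ.pos-* n′ d))) (sym (ℤₚ.pos-+ (n * d) (n′ * d))))))
    (frac-≃ (n * d + n′ * d) (d * d) (n + n′) d (*-mono-< d>0 d>0) d>0 (solve (n ∷ n′ ∷ d-1 ∷ [])))

  ∑-frac : ∀ {k d} (n : Fin k → ℕ) → 0 < d → ∑[ i < k ] frac (n i) d ≃ frac (ℕΣ.sum n) d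
  ∑-frac {zero} {suc d} n _ = *≡* refl
  ∑-frac {suc k} {d} n d>0 =
    ℚᵘₚ.≃-trans (ℚᵘₚ.+-congʳ (frac (n zero) d) (∑-frac (n ∘ suc) d>0)) (frac-+ (n zero) (ℕΣ.sum (n ∘ suc)) d d>0)

  ∑-mono-≤ : ∀ {k} {f g : Fin k → ℚᵘ} → (∀ i → f i ℚᵘ.≤ g i) → sum f ℚᵘ.≤ sum g
  ∑-mono-≤ {zero} _ = ℚᵘₚ.≤-refl
  ∑-mono-≤ {suc k} f≤g = ℚᵘₚ.+-mono-≤ (f≤g zero) (∑-mono-≤ (f≤g ∘ suc))

  ≤-∑ : ∀ {k} (f : Fin k → ℕ) i → f i ≤ ℕΣ.sum f
  ≤-∑ f zero = m≤m+n (f zero) _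
  ≤-∑ f (suc i) = ≤-trans (≤-∑ (f ∘ suc) i) (m≤n+m _ (f zero))

  weighted-pigeonhole : ∀ {n} (w x : Fin n → ℚᵘ) → (∀ c → 0ℚᵘ ℚᵘ.≤ w c) →
    sum w ℚᵘ.< ∑[ c < n ] (w c ℚᵘ.* x c) → ∃ λ c → 1ℚᵘ ℚᵘ.≤ x c
  weighted-pigeonhole w x w≥0 ∑w<∑wx with any? (λ c → 1ℚᵘ ℚᵘₚ.≤? x c)
  ... | yes found = found
  ... | no none = contradiction (∑-mono-≤ wx≤w) (ℚᵘₚ.<⇒≱ ∑w<∑wx)
    where
    wx≤w : ∀ c → w c ℚᵘ.* x c ℚᵘ.≤ w c
    wx≤w c = ℚᵘₚ.≤-respʳ-≃ (ℚᵘₚ.*-identityʳ (w c))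
      (ℚᵘₚ.*-monoʳ-≤-nonNeg (w c) {{ℚᵘ.nonNegative (w≥0 c)}} (ℚᵘₚ.<⇒≤ (ℚᵘₚ.≰⇒> (λ 1≤x → none (c , 1≤x)))))

  toℚᵘ-sumFin : ∀ k (f : Fin k → ℚ.ℚ) → ℚ.toℚᵘ (sumFin k f) ≃ ∑[ i < k ] ℚ.toℚᵘ (f i)
  toℚᵘ-sumFin zero f = *≡* refl
  toℚᵘ-sumFin (suc k) f = ℚᵘₚ.≃-trans (ℚₚ.toℚᵘ-homo-+ (f zero) (sumFin k (f ∘ suc)))
    (ℚᵘₚ.+-congʳ (ℚ.toℚᵘ (f zero)) (toℚᵘ-sumFin k (f ∘ suc)))

  toℚᵘ-recip : ∀ n → 1 ≤ n → ℚ.toℚᵘ (recip n) ≃ frac 1 n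
  toℚᵘ-recip (suc n) _ = ℚₚ.toℚᵘ-fromℚᵘ (mkℚᵘ (+ 1) n)

  ∑1/a-toℚᵘ : ∀ {k} (a : Fin k → ℕ) → (∀ i → 1 ≤ a i) →
    (+ 1546 ℚ./ 1000) ℚ.< sumFin k (λ i → recip (a i)) → frac 1546 1000 ℚᵘ.< ∑[ i < k ] frac 1 (a i)
  ∑1/a-toℚᵘ {k} a a≥1 h = ℚᵘₚ.<-respʳ-≃
    (ℚᵘₚ.≃-trans (toℚᵘ-sumFin k (recip ∘ a)) (sum-cong-≋ (λ i → toℚᵘ-recip (a i) (a≥1 i))))
    (ℚᵘₚ.<-respˡ-≃ (ℚₚ.toℚᵘ-fromℚᵘ (mkℚᵘ (+ 1546) 999)) (ℚₚ.toℚᵘ-mono-< h))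

module DivisibilityChains where

  open import Algebra.Bundles using (Ring)
  open import Data.Fin using (Fin; zero; suc)
  open import Data.Integer as ℤ using (ℤ; +_; _%ℕ_; _/ℕ_)
  import Data.Integer.DivMod as ℤ
  import Data.Integer.Divisibility.Signed as ℤ∣
  import Data.Integer.Properties as ℤₚ
  import Data.Integer.Tactic.RingSolver as ℤ-Solver
  open import Data.List using (List; []; _∷_; [_]; _++_; take; drop; map; applyUpTo)
  open import Data.List.Properties using (take++drop≡id; map-++; applyUpTo-∷ʳ)
  open import Data.Nat
  open import Data.Nat.DivMod
  open import Data.Nat.Divisibility using (_∣_; divides; ∣-trans; ∣m∣n⇒∣m+n; ∣-refl; n∣m*n; _∣0; 1∣_; ∣⇒≤)
  open import Data.Nat.ListAction using (product)
  open import Data.Nat.ListAction.Properties using (product-++)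
  open import Data.Nat.Properties
  open import Data.Product using (Σ; ∃; _×_; _,_; proj₁; proj₂)
  open import Data.Rational.Unnormalised as ℚᵘ using (_≃_; 1ℚᵘ)
  import Data.Rational.Unnormalised.Properties as ℚᵘₚ
  open import Data.Sum using (inj₁; inj₂)
  open import Defs using (Good; Separated)
  open import Function using (_∘_)
  open import Relation.Binary.PropositionalEquality
    using (_≡_; _≢_; refl; sym; trans; cong; cong₂; subst; subst₂; module ≡-Reasoning)
  open import Relation.Nullary using (yes; no; contradiction)

  import Algebra.Properties.Semiring.Sum +-*-semiring as ℕΣ
  open import Algebra.Properties.Semiring.Sum (Ring.semiring ℚᵘₚ.+-*-ring) using (sum-syntax; sum-cong-≋)
  open Fractions

  -- rs encodes the divisibility chain 1 = E 0 ∣ E 1 ∣ ⋯ ∣ E (length rs) = P rs of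
  -- ratios 1 + r; the cofactor B j rs is P rs / E j rs.
  P : List ℕ → ℕ
  P rs = product (map suc rs)

  E B : ℕ → List ℕ → ℕ
  E j rs = P (take j rs)
  B j rs = P (drop j rs)

  P-pos : ∀ rs → 0 < P rs
  P-pos [] = s≤s z≤n
  P-pos (r ∷ rs) = ≤-trans (P-pos rs) (m≤m+n (P rs) (r * P rs))

  E*B≡P : ∀ j rs → E j rs * B j rs ≡ P rs
  E*B≡P j rs = begin
    P (take j rs) * P (drop j rs)                       ≡⟨ product-++ (map suc (take j rs)) _ ⟨
    product (map suc (take j rs) ++ map suc (drop j rs)) ≡⟨ cong product (map-++ suc (take j rs) (drop j rs)) ⟨
    P (take j rs ++ drop j rs)                          ≡⟨ cong P (take++drop≡id j rs) ⟩
    P rs                                                ∎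
    where open ≡-Reasoning

  B-nonZero : ∀ j rs → NonZero (B j rs)
  B-nonZero j rs = >-nonZero (P-pos (drop j rs))

  block : ℕ → List ℕ → ℕ → ℕ
  block j rs v = _/_ v (B j rs) {{B-nonZero j rs}}

  B[1+j]∣B[j] : ∀ j rs → B (suc j) rs ∣ B j rs
  B[1+j]∣B[j] zero [] = ∣-refl
  B[1+j]∣B[j] zero (r ∷ rs) = n∣m*n (suc r)
  B[1+j]∣B[j] (suc j) [] = ∣-refl
  B[1+j]∣B[j] (suc j) (r ∷ rs) = B[1+j]∣B[j] j rs

  -- ρ rs x lists the mixed-radix digits of x (radices 1 + r) in reverse order, so
  -- that the class of x modulo E j is read off from block j rs (ρ rs x).
  ρ : List ℕ → ℕ → ℕ
  ρ [] x = 0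
  ρ (r ∷ rs) x = (x % suc r) * P rs + ρ rs (x / suc r)

  ρ<P : ∀ rs x → ρ rs x < P rs
  ρ<P [] x = s≤s z≤n
  ρ<P (r ∷ rs) x = begin-strict
    (x % suc r) * P rs + ρ rs (x / suc r) <⟨ +-monoʳ-< ((x % suc r) * P rs) (ρ<P rs (x / suc r)) ⟩
    (x % suc r) * P rs + P rs             ≤⟨ +-monoˡ-≤ (P rs) (*-monoˡ-≤ (P rs) (≤-pred (m%n<n x (suc r)))) ⟩
    r * P rs + P rs                       ≡⟨ +-comm (r * P rs) (P rs) ⟩
    P rs + r * P rs                       ∎
    where open ≤-Reasoning

  *+-unique : ∀ {e u u′ s s′} → s < e → s′ < e → u * e + s ≡ u′ * e + s′ → u ≡ u′ × s ≡ s′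
  *+-unique {e} {u} {u′} {s} {s′} s<e s′<e eq = u≡u′ , s≡s′
    where
    instance
      _ : NonZero e
      _ = >-nonZero (≤-trans (s≤s z≤n) s<e)
    %-of-*+ : ∀ v t → t < e → (v * e + t) % e ≡ t
    %-of-*+ v t t<e = trans (cong (_% e) (+-comm (v * e) t)) (trans ([m+kn]%n≡m%n t v e) (m<n⇒m%n≡m t<e))
    s≡s′ : s ≡ s′
    s≡s′ = trans (sym (%-of-*+ u s s<e)) (trans (cong (_% e) eq) (%-of-*+ u′ s′ s′<e))
    u≡u′ : u ≡ u′
    u≡u′ = *-cancelʳ-≡ u u′ e (+-cancelʳ-≡ s (u * e) (u′ * e) (trans eq (cong (λ t → u′ * e + t) (sym s≡s′))))

  x-y≡[x/s-y/s]*s : ∀ x y s .{{_ : NonZero s}} → x % s ≡ y % s →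
    + x ℤ.- + y ≡ (+ (x / s) ℤ.- + (y / s)) ℤ.* + s
  x-y≡[x/s-y/s]*s x y s eq = begin
    + x ℤ.- + y
      ≡⟨ cong₂ (λ u v → + u ℤ.- + v) (m≡m%n+[m/n]*n x s) (m≡m%n+[m/n]*n y s) ⟩
    + (x % s + x / s * s) ℤ.- + (y % s + y / s * s)
      ≡⟨ cong (λ t → + (x % s + x / s * s) ℤ.- + (t + y / s * s)) (sym eq) ⟩
    + (x % s + x / s * s) ℤ.- + (x % s + y / s * s)
      ≡⟨ cancel (x % s) (x / s) (y / s) s ⟩
    (+ (x / s) ℤ.- + (y / s)) ℤ.* + s ∎
    where
    open ≡-Reasoning
    cancel : ∀ m q q′ s → + (m + q * s) ℤ.- + (m + q′ * s) ≡ (+ q ℤ.- + q′) ℤ.* + s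
    cancel m q q′ s = trans (cong₂ ℤ._-_ (cast q) (cast q′)) (identity (+ m) (+ q) (+ q′) (+ s))
      where
      cast : ∀ q → + (m + q * s) ≡ + m ℤ.+ + q ℤ.* + s
      cast q = trans (ℤₚ.pos-+ m (q * s)) (cong (ℤ._+_ (+ m)) (ℤₚ.pos-* q s))
      identity : ∀ m q q′ s → (m ℤ.+ q ℤ.* s) ℤ.- (m ℤ.+ q′ ℤ.* s) ≡ (q ℤ.- q′) ℤ.* s
      identity = ℤ-Solver.solve-∀

  +1∣ : ∀ z → + 1 ℤ∣.∣ z
  +1∣ z = ℤ∣.∣ᵤ⇒∣ (1∣ ℤ.∣ z ∣)

  blockρ≡⇒E∣ : ∀ rs j x y → block j rs (ρ rs x) ≡ block j rs (ρ rs y) → + E j rs ℤ∣.∣ + x ℤ.- + y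
  blockρ≡⇒E∣ rs zero x y _ = +1∣ _
  blockρ≡⇒E∣ [] (suc j) x y _ = +1∣ _
  blockρ≡⇒E∣ (r ∷ rs) (suc j) x y eq =
    subst₂ ℤ∣._∣_ E*[1+r]≡ (sym (x-y≡[x/s-y/s]*s x y (suc r) (proj₁ digits)))
      (ℤ∣.*-monoˡ-∣ (+ suc r) (blockρ≡⇒E∣ rs j (x / suc r) (y / suc r) (proj₂ digits)))
    where
    e = E j rs
    b = B j rs
    instance
      _ : NonZero b
      _ = B-nonZero j rs
    split : ∀ z → ρ (r ∷ rs) z / b ≡ (z % suc r) * e + ρ rs (z / suc r) / b
    split z = begin
      ((z % suc r) * P rs + ρ rs (z / suc r)) / b
        ≡⟨ cong (λ w → ((z % suc r) * w + ρ rs (z / suc r)) / b) (sym (E*B≡P j rs)) ⟩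
      ((z % suc r) * (e * b) + ρ rs (z / suc r)) / b
        ≡⟨ cong (λ w → (w + ρ rs (z / suc r)) / b) (sym (*-assoc (z % suc r) e b)) ⟩
      ((z % suc r) * e * b + ρ rs (z / suc r)) / b
        ≡⟨ +-distrib-/-∣ˡ (ρ rs (z / suc r)) (n∣m*n ((z % suc r) * e)) ⟩
      (z % suc r) * e * b / b + ρ rs (z / suc r) / b
        ≡⟨ cong (_+ ρ rs (z / suc r) / b) (m*n/n≡m ((z % suc r) * e) b) ⟩
      (z % suc r) * e + ρ rs (z / suc r) / b ∎
      where open ≡-Reasoning
    ρ/B<E : ∀ z → ρ rs (z / suc r) / b < e
    ρ/B<E z = m<n*o⇒m/o<n (subst (ρ rs (z / suc r) <_) (sym (E*B≡P j rs)) (ρ<P rs (z / suc r)))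
    digits : x % suc r ≡ y % suc r × ρ rs (x / suc r) / b ≡ ρ rs (y / suc r) / b
    digits = *+-unique (ρ/B<E x) (ρ/B<E y) (trans (sym (split x)) (trans eq (split y)))
    E*[1+r]≡ : + e ℤ.* + suc r ≡ + E (suc j) (r ∷ rs)
    E*[1+r]≡ = trans (ℤₚ.*-comm (+ e) (+ suc r)) (sym (ℤₚ.pos-* (suc r) e))

  δ : ℕ → ℕ → ℕ
  δ i j with i ≟ j
  ... | yes _ = 1
  ... | no _ = 0

  δ-≡ : ∀ {i j} → i ≡ j → δ i j ≡ 1
  δ-≡ {i} {j} i≡j with i ≟ j
  ... | yes _ = refl
  ... | no i≢j = contradiction i≡j i≢j

  δ-≢ : ∀ {i j} → i ≢ j → δ i j ≡ 0
  δ-≢ {i} {j} i≢j with i ≟ j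
  ... | yes i≡j = contradiction i≡j i≢j
  ... | no _ = refl

  count : ∀ {k} → (Fin k → ℕ) → ℕ → ℕ
  count ℓ j = ℕΣ.sum (λ i → δ (ℓ i) j)

  rank : ∀ {k} → (Fin k → ℕ) → Fin k → ℕ
  rank ℓ zero = 0
  rank ℓ (suc i) = δ (ℓ zero) (ℓ (suc i)) + rank (ℓ ∘ suc) i

  rank-onto : ∀ {k} (ℓ : Fin k → ℕ) j t → t < count ℓ j → ∃ λ i → ℓ i ≡ j × rank ℓ i ≡ t
  rank-onto {suc k} ℓ j t t<count with ℓ zero ≟ j
  rank-onto {suc k} ℓ j zero t<count | yes ℓ₀≡j = zero , ℓ₀≡j , refl
  rank-onto {suc k} ℓ j (suc t) t<count | yes ℓ₀≡j =
    let i , ℓi≡j , rank≡t = rank-onto (ℓ ∘ suc) j t (≤-pred t<count)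
    in suc i , ℓi≡j , trans (cong (_+ rank (ℓ ∘ suc) i) (δ-≡ (trans ℓ₀≡j (sym ℓi≡j)))) (cong suc rank≡t)
  ... | no ℓ₀≢j =
    let i , ℓi≡j , rank≡t = rank-onto (ℓ ∘ suc) j t t<count
    in suc i , ℓi≡j , trans (cong (_+ rank (ℓ ∘ suc) i) (δ-≢ (λ e → ℓ₀≢j (trans e ℓi≡j)))) rank≡t

  -- The indices i are laid out on [0, ∑ B (ℓ i)) by increasing level ℓ i, those of level j
  -- in rank order from start j on, each filling one block of length B j.
  start : (rs : List ℕ) {k : ℕ} → (Fin k → ℕ) → ℕ → ℕ
  start rs ℓ zero = 0
  start rs ℓ (suc j) = start rs ℓ j + count ℓ j * B j rs

  B∣start : ∀ rs {k} (ℓ : Fin k → ℕ) j → B j rs ∣ start rs ℓ j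
  B∣start rs ℓ zero = B zero rs ∣0
  B∣start rs ℓ (suc j) =
    ∣m∣n⇒∣m+n (∣-trans (B[1+j]∣B[j] j rs) (B∣start rs ℓ j)) (∣-trans (B[1+j]∣B[j] j rs) (n∣m*n (count ℓ j)))

  sizeBelow : List ℕ → ℕ → ℕ → ℕ
  sizeBelow rs x zero = 0
  sizeBelow rs x (suc n) = sizeBelow rs x n + δ x n * B n rs

  sizeBelow-≥ : ∀ rs {x} n → n ≤ x → sizeBelow rs x n ≡ 0
  sizeBelow-≥ rs zero _ = refl
  sizeBelow-≥ rs (suc n) n<x =
    cong₂ _+_ (sizeBelow-≥ rs n (≤-trans (n≤1+n n) n<x)) (cong (_* B n rs) (δ-≢ (λ e → <⇒≢ n<x (sym e))))

  sizeBelow-< : ∀ rs {x} n → x < n → sizeBelow rs x n ≡ B x rs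
  sizeBelow-< rs {x} (suc n) x<1+n with m≤n⇒m<n∨m≡n (≤-pred x<1+n)
  ... | inj₁ x<n = trans (cong₂ _+_ (sizeBelow-< rs n x<n) (cong (_* B n rs) (δ-≢ (<⇒≢ x<n)))) (+-identityʳ (B x rs))
  ... | inj₂ refl = trans (cong₂ _+_ (sizeBelow-≥ rs x ≤-refl) (cong (_* B x rs) (δ-≡ {x} refl))) (+-identityʳ (B x rs))

  start≡∑sizeBelow : ∀ rs {k} (ℓ : Fin k → ℕ) n → start rs ℓ n ≡ ℕΣ.sum (λ i → sizeBelow rs (ℓ i) n)
  start≡∑sizeBelow rs {k} ℓ zero = sym (ℕΣ.sum-replicate-zero k)
  start≡∑sizeBelow rs ℓ (suc n) = begin
    start rs ℓ n + count ℓ n * B n rs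
      ≡⟨ cong₂ _+_ (start≡∑sizeBelow rs ℓ n) (ℕΣ.*-distribʳ-sum (B n rs) (λ i → δ (ℓ i) n)) ⟩
    ℕΣ.sum (λ i → sizeBelow rs (ℓ i) n) + ℕΣ.sum (λ i → δ (ℓ i) n * B n rs)
      ≡⟨ ℕΣ.∑-distrib-+ (λ i → sizeBelow rs (ℓ i) n) _ ⟨
    ℕΣ.sum (λ i → sizeBelow rs (ℓ i) (suc n)) ∎
    where open ≡-Reasoning

  start≡∑B : ∀ rs {k} (ℓ : Fin k → ℕ) n → (∀ i → ℓ i < n) → start rs ℓ n ≡ ℕΣ.sum (λ i → B (ℓ i) rs)
  start≡∑B rs ℓ n ℓ<n = trans (start≡∑sizeBelow rs ℓ n) (ℕΣ.sum-cong-≗ (λ i → sizeBelow-< rs n (ℓ<n i)))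

  level-of : ∀ rs {k} (ℓ : Fin k → ℕ) M v → v < start rs ℓ (suc M) →
    ∃ λ j → start rs ℓ j ≤ v × v < start rs ℓ (suc j)
  level-of rs ℓ zero v v<start = 0 , z≤n , v<start
  level-of rs ℓ (suc M) v v<start with v <? start rs ℓ (suc M)
  ... | yes v<start′ = level-of rs ℓ M v v<start′
  ... | no v≮start′ = suc M , ≮⇒≥ v≮start′ , v<start

  occupant : ∀ rs {k} (ℓ : Fin k → ℕ) M v → v < start rs ℓ (suc M) →
    ∃ λ i → block (ℓ i) rs v ≡ block (ℓ i) rs (start rs ℓ (ℓ i)) + rank ℓ i
  occupant rs ℓ M v v<start =
    i , subst (λ j → block j rs v ≡ block j rs (start rs ℓ j) + rank ℓ i) (sym ℓi≡j) v-in-block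
    where
    j = proj₁ (level-of rs ℓ M v v<start)
    start≤v = proj₁ (proj₂ (level-of rs ℓ M v v<start))
    v<start′ = proj₂ (proj₂ (level-of rs ℓ M v v<start))
    instance
      _ : NonZero (B j rs)
      _ = B-nonZero j rs
    t = (v ∸ start rs ℓ j) / B j rs
    t<count : t < count ℓ j
    t<count = m<n*o⇒m/o<n (subst (v ∸ start rs ℓ j <_) (m+n∸m≡n (start rs ℓ j) (count ℓ j * B j rs))
      (∸-monoˡ-< v<start′ start≤v))
    i = proj₁ (rank-onto ℓ j t t<count)
    ℓi≡j = proj₁ (proj₂ (rank-onto ℓ j t t<count))
    v-in-block : block j rs v ≡ block j rs (start rs ℓ j) + rank ℓ i
    v-in-block = begin
      v / B j rs
        ≡⟨ cong (_/ B j rs) (m+[n∸m]≡n start≤v) ⟨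
      (start rs ℓ j + (v ∸ start rs ℓ j)) / B j rs
        ≡⟨ +-distrib-/-∣ˡ (v ∸ start rs ℓ j) (B∣start rs ℓ j) ⟩
      start rs ℓ j / B j rs + t
        ≡⟨ cong (_+_ (start rs ℓ j / B j rs)) (proj₂ (proj₂ (rank-onto ℓ j t t<count))) ⟨
      start rs ℓ j / B j rs + rank ℓ i ∎
      where open ≡-Reasoning

  E∣P : ∀ j rs → E j rs ∣ P rs
  E∣P j rs = divides (B j rs) (trans (sym (E*B≡P j rs)) (*-comm (E j rs) (B j rs)))

  ∣%ℕ-diff⇒∣diff : ∀ {e} {d} .{{_ : NonZero d}} n m →
    e ℤ∣.∣ + (n %ℕ d) ℤ.- + (m %ℕ d) → e ℤ∣.∣ + d → e ℤ∣.∣ n ℤ.- m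
  ∣%ℕ-diff⇒∣diff {e} {d} n m e∣residues e∣d = subst (e ℤ∣.∣_) (sym decompose)
    (ℤ∣.∣m∣n⇒∣m+n e∣residues (ℤ∣.∣n⇒∣m*n (n /ℕ d ℤ.- m /ℕ d) e∣d))
    where
    identity : ∀ r q r′ q′ d → (r ℤ.+ q ℤ.* d) ℤ.- (r′ ℤ.+ q′ ℤ.* d) ≡ (r ℤ.- r′) ℤ.+ (q ℤ.- q′) ℤ.* d
    identity = ℤ-Solver.solve-∀
    decompose : n ℤ.- m ≡ (+ (n %ℕ d) ℤ.- + (m %ℕ d)) ℤ.+ (n /ℕ d ℤ.- m /ℕ d) ℤ.* + d
    decompose = trans (cong₂ ℤ._-_ (ℤ.a≡a%ℕn+[a/ℕn]*n n d) (ℤ.a≡a%ℕn+[a/ℕn]*n m d))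
      (identity (+ (n %ℕ d)) (n /ℕ d) (+ (m %ℕ d)) (m /ℕ d) (+ d))

  -- The hypothesis says ∑ 1/E (ℓ i) ≥ 1.
  chain-cover : ∀ rs {k} (ℓ : Fin k → ℕ) → P rs ≤ ℕΣ.sum (λ i → B (ℓ i) rs) →
    Σ (ℤ → Fin k) λ colour → ∀ n m → colour n ≡ colour m → + E (ℓ (colour n)) rs ℤ∣.∣ n ℤ.- m
  chain-cover rs {k} ℓ P≤∑B = colour , same-colour⇒E∣
    where
    M = ℕΣ.sum ℓ
    ρ<start : ∀ x → ρ rs x < start rs ℓ (suc M)
    ρ<start x = <-≤-trans (ρ<P rs x)
      (≤-trans P≤∑B (≤-reflexive (sym (start≡∑B rs ℓ (suc M) (λ i → s≤s (≤-∑ ℓ i))))))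
    occupantOf : ℕ → Fin k
    occupantOf x = proj₁ (occupant rs ℓ M (ρ rs x) (ρ<start x))
    same-block : ∀ x y → occupantOf x ≡ occupantOf y →
      block (ℓ (occupantOf x)) rs (ρ rs x) ≡ block (ℓ (occupantOf x)) rs (ρ rs y)
    same-block x y eq = trans (proj₂ (occupant rs ℓ M (ρ rs x) (ρ<start x)))
      (sym (subst (λ i → block (ℓ i) rs (ρ rs y) ≡ block (ℓ i) rs (start rs ℓ (ℓ i)) + rank ℓ i) (sym eq)
        (proj₂ (occupant rs ℓ M (ρ rs y) (ρ<start y)))))
    instance
      _ : NonZero (P rs)
      _ = >-nonZero (P-pos rs)
    colour : ℤ → Fin k
    colour n = occupantOf (n %ℕ P rs)
    same-colour⇒E∣ : ∀ n m → colour n ≡ colour m → + E (ℓ (colour n)) rs ℤ∣.∣ n ℤ.- m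
    same-colour⇒E∣ n m eq = ∣%ℕ-diff⇒∣diff n m
      (blockρ≡⇒E∣ rs (ℓ (colour n)) (n %ℕ P rs) (m %ℕ P rs) (same-block (n %ℕ P rs) (m %ℕ P rs) eq))
      (ℤ∣.∣ᵤ⇒∣ (E∣P (ℓ (colour n)) rs))

  chainModulus : (ℕ → ℕ) → ℕ → ℕ
  chainModulus f j = P (applyUpTo f j)

  chainModulus-suc : ∀ f j → chainModulus f (suc j) ≡ chainModulus f j * suc (f j)
  chainModulus-suc f j = begin
    P (applyUpTo f (suc j))                             ≡⟨ cong P (applyUpTo-∷ʳ f j) ⟨
    product (map suc (applyUpTo f j ++ [ f j ]))        ≡⟨ cong product (map-++ suc (applyUpTo f j) [ f j ]) ⟩
    product (map suc (applyUpTo f j) ++ [ suc (f j) ])  ≡⟨ product-++ (map suc (applyUpTo f j)) [ suc (f j) ] ⟩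
    chainModulus f j * (suc (f j) * 1)                  ≡⟨ cong (chainModulus f j *_) (*-identityʳ (suc (f j))) ⟩
    chainModulus f j * suc (f j)                        ∎
    where open ≡-Reasoning

  ∣diff⇒Separated : ∀ {e} (S : ℤ → Set) → (∀ n m → S n → S m → + e ℤ∣.∣ n ℤ.- m) → Separated e S
  ∣diff⇒Separated S e∣ n m Sn Sm n≢m = ∣⇒≤ {{≢-nonZero ∣n-m∣≢0}} (ℤ∣.∣⇒∣ᵤ (e∣ n m Sn Sm))
    where
    ∣n-m∣≢0 : ℤ.∣ n ℤ.- m ∣ ≢ 0
    ∣n-m∣≢0 eq = n≢m (ℤₚ.i-j≡0⇒i≡j n m (ℤₚ.∣i∣≡0⇒i≡0 eq))

  Separated-≤ : ∀ {a e} {S : ℤ → Set} → a ≤ e → Separated e S → Separated a S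
  Separated-≤ a≤e sep n m Sn Sm n≢m = ≤-trans a≤e (sep n m Sn Sm n≢m)

  take-applyUpTo : ∀ (f : ℕ → ℕ) {j M} → j ≤ M → take j (applyUpTo f M) ≡ applyUpTo f j
  take-applyUpTo f {zero} _ = refl
  take-applyUpTo f {suc j} {suc M} (s≤s j≤M) = cong (f 0 ∷_) (take-applyUpTo (f ∘ suc) j≤M)

  good-from-chain : ∀ (f : ℕ → ℕ) {k} (a ℓ : Fin k → ℕ) → (∀ i → a i ≤ chainModulus f (ℓ i)) →
    1ℚᵘ ℚᵘ.≤ ∑[ i < k ] frac 1 (chainModulus f (ℓ i)) → Good k a
  good-from-chain f {k} a ℓ a≤E 1≤∑ = S , separated , (λ n → colour n , refl)
    where
    rs = applyUpTo f (ℕΣ.sum ℓ)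
    E≡ : ∀ i → E (ℓ i) rs ≡ chainModulus f (ℓ i)
    E≡ i = cong P (take-applyUpTo f (≤-∑ ℓ i))
    unit≃B/P : ∀ i → frac 1 (chainModulus f (ℓ i)) ≃ frac (B (ℓ i) rs) (P rs)
    unit≃B/P i = frac-≃ 1 _ (B (ℓ i) rs) (P rs) (subst (0 <_) (E≡ i) (P-pos (take (ℓ i) rs))) (P-pos rs)
      (trans (+-identityʳ (P rs)) (trans (sym (E*B≡P (ℓ i) rs)) (trans (*-comm (E (ℓ i) rs) _) (cong (B (ℓ i) rs *_) (E≡ i)))))
    P≤∑B : P rs ≤ ℕΣ.sum (λ i → B (ℓ i) rs)
    P≤∑B = subst₂ _≤_ (+-identityʳ (P rs)) (*-identityʳ _) (frac-≤⁻ 1 1 _ (P rs) (s≤s z≤n) (P-pos rs)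
      (ℚᵘₚ.≤-respʳ-≃ (ℚᵘₚ.≃-trans (sum-cong-≋ unit≃B/P) (∑-frac (λ i → B (ℓ i) rs) (P-pos rs))) 1≤∑))
    colour = proj₁ (chain-cover rs ℓ P≤∑B)
    S : Fin k → ℤ → Set
    S i n = colour n ≡ i
    E∣ : ∀ i n m → S i n → S i m → + chainModulus f (ℓ i) ℤ∣.∣ n ℤ.- m
    E∣ i n m refl Sm = subst (λ e → + e ℤ∣.∣ n ℤ.- m) (E≡ (colour n)) (proj₂ (chain-cover rs ℓ P≤∑B) n m (sym Sm))
    separated : ∀ i → Separated (a i) (S i)
    separated i = Separated-≤ (a≤E i) (∣diff⇒Separated (S i) (E∣ i))

module SevenChains where

  open import Algebra.Bundles using (Ring)
  open import Data.Bool using (if_then_else_)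
  open import Data.Fin using (Fin; zero; suc; toℕ; fromℕ<)
  open import Data.Fin.Properties using (all?; toℕ-fromℕ<)
  open import Data.List using ([]; _∷_; applyUpTo)
  open import Data.Nat
  open import Data.Nat.Induction using (<-rec)
  open import Data.Nat.Properties
  open import Data.Nat.Tactic.RingSolver using (solve; solve-∀)
  open import Data.Product using (∃; _×_; _,_; proj₁; proj₂)
  open import Data.Rational.Unnormalised as ℚᵘ using (ℚᵘ; _≃_; *≡*; 1ℚᵘ)
  import Data.Rational.Unnormalised.Properties as ℚᵘₚ
  open import Data.Sum using (_⊎_; inj₁; inj₂)
  open import Relation.Binary.PropositionalEquality
    using (_≡_; refl; sym; trans; cong; subst; subst₂; module ≡-Reasoning)
  open import Relation.Nullary using (Dec; yes; no; contradiction)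
  open import Relation.Nullary.Decidable using (toWitness; _×-dec_)

  open import Algebra.Properties.Semiring.Sum (Ring.semiring ℚᵘₚ.+-*-ring)
    using (sum; sum-syntax; sum-cong-≋; ∑-comm; *-distribˡ-sum)
  open Fractions
  open DivisibilityChains using (P; P-pos; chainModulus; chainModulus-suc)

  ⌈a/2⌉<a : ∀ {a} → 1 < a → ⌈ a /2⌉ < a
  ⌈a/2⌉<a {suc zero} (s≤s ())
  ⌈a/2⌉<a {suc (suc a)} _ = ⌈n/2⌉<n a

  a≡2⌈a/2⌉⊎1+a≡2⌈a/2⌉ : ∀ a → a ≡ 2 * ⌈ a /2⌉ ⊎ suc a ≡ 2 * ⌈ a /2⌉
  a≡2⌈a/2⌉⊎1+a≡2⌈a/2⌉ zero = inj₁ refl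
  a≡2⌈a/2⌉⊎1+a≡2⌈a/2⌉ (suc zero) = inj₂ refl
  a≡2⌈a/2⌉⊎1+a≡2⌈a/2⌉ (suc (suc a)) with a≡2⌈a/2⌉⊎1+a≡2⌈a/2⌉ a
  ... | inj₁ e = inj₁ (trans (cong (λ z → suc (suc z)) e) (cong suc (sym (+-suc ⌈ a /2⌉ (⌈ a /2⌉ + 0)))))
  ... | inj₂ e = inj₂ (trans (cong (λ z → suc (suc z)) e) (cong suc (sym (+-suc ⌈ a /2⌉ (⌈ a /2⌉ + 0)))))

  a≤2⌈a/2⌉ : ∀ a → a ≤ 2 * ⌈ a /2⌉
  a≤2⌈a/2⌉ a with a≡2⌈a/2⌉⊎1+a≡2⌈a/2⌉ a
  ... | inj₁ e = ≤-reflexive e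
  ... | inj₂ e = ≤-trans (n≤1+n a) (≤-reflexive e)

  33≤⌈a/2⌉ : ∀ {a} → 64 < a → 33 ≤ ⌈ a /2⌉
  33≤⌈a/2⌉ = ⌈n/2⌉-mono

  halving-induction : ∀ {p} (Q : ℕ → Set p) N → 1 ≤ N →
    (∀ a → a ≤ N → Q a) → (∀ a → N < a → Q ⌈ a /2⌉ → Q a) → ∀ a → Q a
  halving-induction Q N 1≤N base step = <-rec Q go
    where
    go : ∀ a → (∀ {b} → b < a → Q b) → Q a
    go a rec with a ≤? N
    ... | yes a≤N = base a a≤N
    ... | no a≰N = step a (≰⇒> a≰N) (rec (⌈a/2⌉<a (≤-<-trans 1≤N (≰⇒> a≰N))))

  check-range : ∀ {p} (Q : ℕ → Set p) lo n → (∀ (i : Fin n) → Q (lo + toℕ i)) → ∀ a → lo ≤ a → a < lo + n → Q a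
  check-range Q lo n holds a lo≤a a<lo+n =
    subst Q (m+[n∸m]≡n lo≤a) (subst (λ t → Q (lo + t)) (toℕ-fromℕ< a∸lo<n) (holds (fromℕ< a∸lo<n)))
    where
    a∸lo<n : a ∸ lo < n
    a∸lo<n = subst (a ∸ lo <_) (m+n∸m≡n lo n) (∸-monoˡ-< a<lo+n lo≤a)

  -- The chains begin 1,2,4,8 | 1,2,4,12 | 1,3,6,18 | 1,3,9,27 | 1,5,10,20 | 1,7,14,42 |
  -- 1,5,15,30 and double from then on.
  ratio : Fin 7 → ℕ → ℕ
  ratio zero j = 1
  ratio (suc zero) 2 = 2
  ratio (suc zero) j = 1
  ratio (suc (suc zero)) 0 = 2
  ratio (suc (suc zero)) 2 = 2
  ratio (suc (suc zero)) j = 1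
  ratio (suc (suc (suc zero))) 0 = 2
  ratio (suc (suc (suc zero))) 1 = 2
  ratio (suc (suc (suc zero))) 2 = 2
  ratio (suc (suc (suc zero))) j = 1
  ratio (suc (suc (suc (suc zero)))) 0 = 4
  ratio (suc (suc (suc (suc zero)))) j = 1
  ratio (suc (suc (suc (suc (suc zero))))) 0 = 6
  ratio (suc (suc (suc (suc (suc zero))))) 2 = 2
  ratio (suc (suc (suc (suc (suc zero))))) j = 1
  ratio (suc (suc (suc (suc (suc (suc zero)))))) 0 = 4
  ratio (suc (suc (suc (suc (suc (suc zero)))))) 1 = 2
  ratio (suc (suc (suc (suc (suc (suc zero)))))) j = 1

  ratio-≥3 : ∀ c j → ratio c (3 + j) ≡ 1
  ratio-≥3 zero j = refl
  ratio-≥3 (suc zero) j = refl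
  ratio-≥3 (suc (suc zero)) j = refl
  ratio-≥3 (suc (suc (suc zero))) j = refl
  ratio-≥3 (suc (suc (suc (suc zero)))) j = refl
  ratio-≥3 (suc (suc (suc (suc (suc zero))))) j = refl
  ratio-≥3 (suc (suc (suc (suc (suc (suc zero)))))) j = refl

  weight : Fin 7 → ℕ
  weight zero = 8
  weight (suc zero) = 7
  weight (suc (suc zero)) = 5
  weight (suc (suc (suc zero))) = 4
  weight (suc (suc (suc (suc zero)))) = 5
  weight (suc (suc (suc (suc (suc zero))))) = 1
  weight (suc (suc (suc (suc (suc (suc zero)))))) = 1

  firstLevelAbove : (ℕ → ℕ) → ℕ → ℕ → ℕ → ℕ
  firstLevelAbove E a j zero = j
  firstLevelAbove E a j (suc fuel) = if a ≤ᵇ E j then j else firstLevelAbove E a (suc j) fuel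

  -- Above 64 the level of a is one more than that of ⌈a/2⌉; the fuel a suffices.
  levelWithFuel : Fin 7 → ℕ → ℕ → ℕ
  levelWithFuel c zero a = 0
  levelWithFuel c (suc fuel) a with a ≤? 64
  ... | yes _ = firstLevelAbove (chainModulus (ratio c)) a 0 9
  ... | no _ = suc (levelWithFuel c fuel ⌈ a /2⌉)

  level : Fin 7 → ℕ → ℕ
  level c a = levelWithFuel c a a

  roundUp : Fin 7 → ℕ → ℕ
  roundUp c a = chainModulus (ratio c) (level c a)

  roundUp-pos : ∀ c a → 0 < roundUp c a
  roundUp-pos c a = P-pos (applyUpTo (ratio c) (level c a))

  weightedSum : ℕ → ℚᵘ
  weightedSum a = ∑[ c < 7 ] frac (weight c) (roundUp c a)

  levelWithFuel-fuel : ∀ c {fuel fuel′} a → a ≤ fuel → a ≤ fuel′ → levelWithFuel c fuel a ≡ levelWithFuel c fuel′ a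
  levelWithFuel-fuel c {zero} {zero} a _ _ = refl
  levelWithFuel-fuel c {zero} {suc _} zero _ _ = refl
  levelWithFuel-fuel c {suc _} {zero} zero _ _ = refl
  levelWithFuel-fuel c {suc fuel} {suc fuel′} a a≤fuel a≤fuel′ with a ≤? 64
  ... | yes _ = refl
  ... | no a≰64 = cong suc (levelWithFuel-fuel c ⌈ a /2⌉ (shrink a≤fuel) (shrink a≤fuel′))
    where
    shrink : ∀ {n} → a ≤ suc n → ⌈ a /2⌉ ≤ n
    shrink a≤1+n = ≤-pred (≤-trans (⌈a/2⌉<a (≤-trans (s≤s (s≤s z≤n)) (≰⇒> a≰64))) a≤1+n)

  level-halve : ∀ c a → 64 < a → level c a ≡ suc (level c ⌈ a /2⌉)
  level-halve c a@(suc a-1) 64<a with a ≤? 64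
  ... | yes a≤64 = contradiction a≤64 (<⇒≱ 64<a)
  ... | no _ = cong suc (levelWithFuel-fuel c ⌈ a /2⌉ (≤-pred (⌈a/2⌉<a (≤-trans (s≤s (s≤s z≤n)) 64<a))) ≤-refl)

  -- κ = 31/1.546, and 31 is the total weight.
  κ : ℚᵘ
  κ = frac 15500 773

  SmallCase : ℕ → Set
  SmallCase a = (∀ c → a ≤ roundUp c a) × κ ℚᵘ.* frac 1 a ℚᵘ.≤ weightedSum a

  small-case : ∀ a → 1 ≤ a → a ≤ 64 → SmallCase a
  small-case a 1≤a a≤64 =
    check-range SmallCase 1 64 (toWitness {a? = all? (λ i → small? (1 + toℕ i))} _) a 1≤a (s≤s a≤64)
    where
    small? : ∀ a → Dec (SmallCase a)
    small? a = all? (λ c → a ≤? roundUp c a) ×-dec (κ ℚᵘ.* frac 1 a ℚᵘₚ.≤? weightedSum a)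

  -- (a + 2)/a² rather than 1/a, because it at least halves in passing from ⌈a/2⌉ to a.
  bound : ℕ → ℚᵘ
  bound a = κ ℚᵘ.* frac (a + 2) (a * a)

  MediumCase : ℕ → Set
  MediumCase a = (∀ c → 3 ≤ level c a) × bound a ℚᵘ.≤ weightedSum a

  medium-case : ∀ a → 33 ≤ a → a ≤ 64 → MediumCase a
  medium-case a 33≤a a≤64 =
    check-range MediumCase 33 32 (toWitness {a? = all? (λ i → medium? (33 + toℕ i))} _) a 33≤a (s≤s a≤64)
    where
    medium? : ∀ a → Dec (MediumCase a)
    medium? a = all? (λ c → 3 ≤? level c a) ×-dec (bound a ℚᵘₚ.≤? weightedSum a)

  3≤level : ∀ c a → 33 ≤ a → 3 ≤ level c a
  3≤level c = halving-induction (λ a → 33 ≤ a → 3 ≤ level c a) 64 (s≤s z≤n)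
    (λ a a≤64 33≤a → proj₁ (medium-case a 33≤a a≤64) c)
    (λ a 64<a ih _ → subst (3 ≤_) (sym (level-halve c a 64<a)) (≤-trans (ih (33≤⌈a/2⌉ 64<a)) (n≤1+n _)))

  roundUp-double : ∀ c a → 64 < a → roundUp c a ≡ 2 * roundUp c ⌈ a /2⌉
  roundUp-double c a 64<a = begin
    chainModulus (ratio c) (level c a)   ≡⟨ cong (chainModulus (ratio c)) (level-halve c a 64<a) ⟩
    chainModulus (ratio c) (suc l)       ≡⟨ chainModulus-suc (ratio c) l ⟩
    roundUp c ⌈ a /2⌉ * suc (ratio c l)  ≡⟨ cong (λ r → roundUp c ⌈ a /2⌉ * suc r) ratio≡1 ⟩
    roundUp c ⌈ a /2⌉ * 2                ≡⟨ *-comm (roundUp c ⌈ a /2⌉) 2 ⟩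
    2 * roundUp c ⌈ a /2⌉                ∎
    where
    open ≡-Reasoning
    l = level c ⌈ a /2⌉
    ratio≡1 : ratio c l ≡ 1
    ratio≡1 = subst (λ j → ratio c j ≡ 1) (m+[n∸m]≡n (3≤level c ⌈ a /2⌉ (33≤⌈a/2⌉ 64<a))) (ratio-≥3 c (l ∸ 3))

  ≤-roundUp : ∀ c a → 1 ≤ a → a ≤ roundUp c a
  ≤-roundUp c = halving-induction (λ a → 1 ≤ a → a ≤ roundUp c a) 64 (s≤s z≤n)
    (λ a a≤64 1≤a → proj₁ (small-case a 1≤a a≤64) c)
    (λ a 64<a ih _ → begin
      a                      ≤⟨ a≤2⌈a/2⌉ a ⟩
      2 * ⌈ a /2⌉            ≤⟨ *-monoʳ-≤ 2 (ih (≤-trans (s≤s z≤n) (33≤⌈a/2⌉ 64<a))) ⟩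
      2 * roundUp c ⌈ a /2⌉  ≡⟨ roundUp-double c a 64<a ⟨
      roundUp c a            ∎)
    where open ≤-Reasoning

  weightedSum-halve : ∀ a → 64 < a → weightedSum a ≃ frac 1 2 ℚᵘ.* weightedSum ⌈ a /2⌉
  weightedSum-halve a 64<a =
    ℚᵘₚ.≃-trans (sum-cong-≋ halve) (ℚᵘₚ.≃-sym (*-distribˡ-sum (frac 1 2) (λ c → frac (weight c) (roundUp c a′))))
    where
    a′ = ⌈ a /2⌉
    halve : ∀ c → frac (weight c) (roundUp c a) ≃ frac 1 2 ℚᵘ.* frac (weight c) (roundUp c a′)
    halve c = ℚᵘₚ.≃-trans
      (frac-≃ (weight c) (roundUp c a) (1 * weight c) (2 * roundUp c a′)
        (roundUp-pos c a) (*-mono-< {0} {2} (s≤s z≤n) (roundUp-pos c a′))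
        (trans (cong (weight c *_) (sym (roundUp-double c a 64<a))) (cong (_* roundUp c a) (sym (*-identityˡ (weight c))))))
      (ℚᵘₚ.≃-sym (frac-* 1 2 (weight c) (roundUp c a′) (s≤s z≤n) (roundUp-pos c a′)))

  2a′²[a+2]≤a²[a′+2] : ∀ a a′ → 4 ≤ a′ → a ≡ 2 * a′ ⊎ suc a ≡ 2 * a′ →
    2 * (a′ * a′) * (a + 2) ≤ a * a * (a′ + 2)
  2a′²[a+2]≤a²[a′+2] _ a′ _ (inj₁ refl) = ≤-trans (m≤m+n _ (4 * (a′ * a′))) (≤-reflexive (solve (a′ ∷ [])))
  2a′²[a+2]≤a²[a′+2] a a′ 4≤a′ (inj₂ 1+a≡2a′) =
    subst₂ (λ a′ a → 2 * (a′ * a′) * (a + 2) ≤ a * a * (a′ + 2)) a′≡t+4 a≡2t+7 (odd t)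
    where
    t = a′ ∸ 4
    a′≡t+4 : t + 4 ≡ a′
    a′≡t+4 = trans (+-comm t 4) (m+[n∸m]≡n 4≤a′)
    2t+8≡2[t+4] : ∀ t → suc (2 * t + 7) ≡ 2 * (t + 4)
    2t+8≡2[t+4] = solve-∀
    a≡2t+7 : 2 * t + 7 ≡ a
    a≡2t+7 = suc-injective (trans (2t+8≡2[t+4] t) (trans (cong (2 *_) a′≡t+4) (sym 1+a≡2a′)))
    odd : ∀ t → 2 * ((t + 4) * (t + 4)) * (2 * t + 7 + 2) ≤ (2 * t + 7) * (2 * t + 7) * (t + 4 + 2)
    odd t = ≤-trans (m≤m+n _ (2 * t * t + 9 * t + 6)) (≤-reflexive (solve (t ∷ [])))

  bound-≤-half : ∀ a a′ → 1 ≤ a → 1 ≤ a′ → 2 * (a′ * a′) * (a + 2) ≤ a * a * (a′ + 2) →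
    bound a ℚᵘ.≤ frac 1 2 ℚᵘ.* bound a′
  bound-≤-half a a′ 1≤a 1≤a′ ineq = begin
    κ ℚᵘ.* frac (a + 2) (a * a)
      ≤⟨ ℚᵘₚ.*-monoʳ-≤-nonNeg κ halved ⟩
    κ ℚᵘ.* frac (1 * (a′ + 2)) (2 * (a′ * a′))
      ≃⟨ ℚᵘₚ.*-congˡ {κ} (frac-* 1 2 (a′ + 2) (a′ * a′) (s≤s z≤n) (b²-pos a′ 1≤a′)) ⟨
    κ ℚᵘ.* (frac 1 2 ℚᵘ.* frac (a′ + 2) (a′ * a′))
      ≡⟨ swap κ (frac 1 2) (frac (a′ + 2) (a′ * a′)) ⟩
    frac 1 2 ℚᵘ.* (κ ℚᵘ.* frac (a′ + 2) (a′ * a′)) ∎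
    where
    open ℚᵘₚ.≤-Reasoning
    b²-pos : ∀ b → 1 ≤ b → 0 < b * b
    b²-pos b 1≤b = *-mono-< {0} {b} 1≤b 1≤b
    cross : (a + 2) * (2 * (a′ * a′)) ≤ 1 * (a′ + 2) * (a * a)
    cross = ≤-trans (≤-reflexive lhs) (≤-trans ineq (≤-reflexive rhs))
      where
      lhs : (a + 2) * (2 * (a′ * a′)) ≡ 2 * (a′ * a′) * (a + 2)
      lhs = solve (a ∷ a′ ∷ [])
      rhs : a * a * (a′ + 2) ≡ 1 * (a′ + 2) * (a * a)
      rhs = solve (a ∷ a′ ∷ [])
    halved : frac (a + 2) (a * a) ℚᵘ.≤ frac (1 * (a′ + 2)) (2 * (a′ * a′))
    halved = frac-≤ (a + 2) (a * a) (1 * (a′ + 2)) (2 * (a′ * a′))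
      (b²-pos a 1≤a) (*-mono-< {0} {2} (s≤s z≤n) (b²-pos a′ 1≤a′)) cross
    swap : ∀ x y z → x ℚᵘ.* (y ℚᵘ.* z) ≡ y ℚᵘ.* (x ℚᵘ.* z)
    swap x y z = trans (sym (ℚᵘₚ.*-assoc-≡ x y z)) (trans (cong (ℚᵘ._* z) (ℚᵘₚ.*-comm-≡ x y)) (ℚᵘₚ.*-assoc-≡ y x z))

  bound≤weightedSum : ∀ a → 33 ≤ a → bound a ℚᵘ.≤ weightedSum a
  bound≤weightedSum = halving-induction (λ a → 33 ≤ a → bound a ℚᵘ.≤ weightedSum a) 64 (s≤s z≤n)
    (λ a a≤64 33≤a → proj₂ (medium-case a 33≤a a≤64))
    (λ a 64<a ih _ → let a′ = ⌈ a /2⌉ ; 33≤a′ = 33≤⌈a/2⌉ 64<a in begin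
      bound a                       ≤⟨ bound-≤-half a a′ (≤-trans (s≤s z≤n) 64<a) (≤-trans (s≤s z≤n) 33≤a′)
                                         (2a′²[a+2]≤a²[a′+2] a a′ (≤-trans (s≤s (s≤s (s≤s (s≤s z≤n)))) 33≤a′) (a≡2⌈a/2⌉⊎1+a≡2⌈a/2⌉ a)) ⟩
      frac 1 2 ℚᵘ.* bound a′         ≤⟨ ℚᵘₚ.*-monoʳ-≤-nonNeg (frac 1 2) (ih 33≤a′) ⟩
      frac 1 2 ℚᵘ.* weightedSum a′   ≃⟨ weightedSum-halve a 64<a ⟨
      weightedSum a                 ∎)
    where open ℚᵘₚ.≤-Reasoning

  weightedSum-bound : ∀ a → 1 ≤ a → κ ℚᵘ.* frac 1 a ℚᵘ.≤ weightedSum a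
  weightedSum-bound a 1≤a with a ≤? 64
  ... | yes a≤64 = proj₂ (small-case a 1≤a a≤64)
  ... | no a≰64 = ℚᵘₚ.≤-trans
    (ℚᵘₚ.*-monoʳ-≤-nonNeg κ (frac-≤ 1 a (a + 2) (a * a) 1≤a (*-mono-< {0} {a} 1≤a 1≤a) a²≤[a+2]a))
    (bound≤weightedSum a (≤-trans (m≤m+n 33 32) (≰⇒> a≰64)))
    where
    a²≤[a+2]a : 1 * (a * a) ≤ (a + 2) * a
    a²≤[a+2]a = subst (_≤ (a + 2) * a) (sym (*-identityˡ (a * a))) (*-monoˡ-≤ a (m≤m+n a 2))

  covering-chain : ∀ {k} (a : Fin k → ℕ) → (∀ i → 1 ≤ a i) → frac 1546 1000 ℚᵘ.< ∑[ i < k ] frac 1 (a i) →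
    ∃ λ c → 1ℚᵘ ℚᵘ.≤ ∑[ i < k ] frac 1 (roundUp c (a i))
  covering-chain {k} a a≥1 ∑1/a-large = weighted-pigeonhole w x (λ c → ℚᵘₚ.nonNegative⁻¹ (w c)) (begin-strict
    sum w                                                ≃⟨ *≡* refl ⟩
    κ ℚᵘ.* frac 1546 1000                                <⟨ ℚᵘₚ.*-monoʳ-<-pos κ ∑1/a-large ⟩
    κ ℚᵘ.* ∑[ i < k ] frac 1 (a i)                       ≃⟨ *-distribˡ-sum κ (λ i → frac 1 (a i)) ⟩
    ∑[ i < k ] (κ ℚᵘ.* frac 1 (a i))                     ≤⟨ ∑-mono-≤ (λ i → weightedSum-bound (a i) (a≥1 i)) ⟩
    ∑[ i < k ] weightedSum (a i)                         ≃⟨ ∑-comm (λ i c → frac (weight c) (roundUp c (a i))) ⟩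
    ∑[ c < 7 ] ∑[ i < k ] frac (weight c) (roundUp c (a i)) ≃⟨ sum-cong-≋ factor ⟩
    ∑[ c < 7 ] (w c ℚᵘ.* x c)                             ∎)
    where
    open ℚᵘₚ.≤-Reasoning
    w : Fin 7 → ℚᵘ
    w c = frac (weight c) 1
    x : Fin 7 → ℚᵘ
    x c = ∑[ i < k ] frac 1 (roundUp c (a i))
    factor : ∀ c → ∑[ i < k ] frac (weight c) (roundUp c (a i)) ≃ w c ℚᵘ.* x c
    factor c = ℚᵘₚ.≃-trans (sum-cong-≋ split) (ℚᵘₚ.≃-sym (*-distribˡ-sum (w c) (λ i → frac 1 (roundUp c (a i)))))
      where
      split : ∀ i → frac (weight c) (roundUp c (a i)) ≃ w c ℚᵘ.* frac 1 (roundUp c (a i))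
      split i = frac≃n*1/d (weight c) (roundUp c (a i)) (roundUp-pos c (a i))

open import Defs
open import Data.Nat using (ℕ; _≤_)
open import Data.Fin using (Fin)
open import Data.Integer using (+_)
open import Data.Rational using (_/_; _<_)
open import Data.Product using (_,_)
open import Function using (_∘_)
open Fractions using (∑1/a-toℚᵘ)
open DivisibilityChains using (good-from-chain)
open SevenChains using (ratio; level; ≤-roundUp; covering-chain)

theorem7 : (k : ℕ) (a : Fin k → ℕ) → (∀ i → 1 ≤ a i) →
    (+ 1546 / 1000) < sumFin k (λ i → recip (a i)) → Good k a
theorem7 k a a≥1 h =
  let c , 1≤∑ = covering-chain a a≥1 (∑1/a-toℚᵘ a a≥1 h)
  in good-from-chain (ratio c) a (level c ∘ a) (λ i → ≤-roundUp c (a i) (a≥1 i)) 1≤∑
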